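{- Let $m\ge 0$ be an integer and let $G$ be a graph on $n$ vertices with $n\ge 8m$. Let $c$ be a proper edge coloring of $G$ with total color degree $\hat d(G)\ge 2mn$. Then $G$ contains a rainbow matching (with respect to $c$) of size $m$.
   Context: All graphs are finite and simple. An edge coloring $c:E(G)\to[r]$ is proper if any two distinct edges sharing a vertex receive different colors. For a vertex $v$, the color degree $\hat d(v)$ is the number of distinct colors that $c$ assigns to edges incident to $v$. The total color degree of $G$ is $\hat d(G)=\sum_{v\in V(G)}\hat d(v)$. A matching of size $k$ is a set of $k$ pairwise vertex-disjoint edges; it is rainbow if its edges receive pairwise distinct colors. -}

module Defs where

open import Data.Bool using (Bool; true; false; T)
open import Data.Nat using (ℕ; _+_; _≟_)
open import Data.Fin using (Fin)
open import Data.List using (List; []; _∷_; map; filter; allFin; deduplicate; length)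
open import Data.Nat.ListAction using (sum)
open import Data.List.Relation.Unary.All using (All)
open import Data.List.Relation.Unary.Unique.Propositional using (Unique)
open import Data.Product using (_×_; _,_; proj₁; proj₂; Σ)
open import Relation.Binary.PropositionalEquality using (_≡_)
open import Relation.Nullary using (¬_)
open import Relation.Nullary.Decidable using (T?)

record Graph (n : ℕ) : Set where
  field
    adj       : Fin n → Fin n → Bool
    adj-sym   : ∀ u v → adj u v ≡ adj v u
    adj-irrefl : ∀ v → adj v v ≡ false
open Graph public

-- An edge coloring: colors in ℕ (values on non-edges are irrelevant);
-- the color of edge uv is c u v, which must agree with c v u.
Coloring : ℕ → Set
Coloring n = Fin n → Fin n → ℕ

IsEdgeColoring : ∀ {n} → Graph n → Coloring n → Set
IsEdgeColoring G c = ∀ u v → T (adj G u v) → c u v ≡ c v u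

IsProper : ∀ {n} → Graph n → Coloring n → Set
IsProper G c = ∀ u v w → T (adj G u v) → T (adj G u w) → ¬ (v ≡ w) → ¬ (c u v ≡ c u w)

nbrs : ∀ {n} → Graph n → Fin n → List (Fin n)
nbrs {n} G v = filter (λ u → T? (adj G v u)) (allFin n)

colorDegree : ∀ {n} → Graph n → Coloring n → Fin n → ℕ
colorDegree G c v = length (deduplicate _≟_ (map (c v) (nbrs G v)))

totalColorDegree : ∀ {n} → Graph n → Coloring n → ℕ
totalColorDegree {n} G c = sum (map (colorDegree G c) (allFin n))

endpoints : ∀ {n} → List (Fin n × Fin n) → List (Fin n)
endpoints [] = []
endpoints ((u , v) ∷ es) = u ∷ v ∷ endpoints es

IsRainbowMatching : ∀ {n} → Graph n → Coloring n → List (Fin n × Fin n) → Set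
IsRainbowMatching G c M =
  All (λ e → T (adj G (proj₁ e) (proj₂ e))) M
  × Unique (endpoints M)
  × Unique (map (λ e → c (proj₁ e) (proj₂ e)) M)

-- Write m = m′ + 1. Call a vertex rich if its degree exceeds 3m′, a colour rich if it is
-- carried by more than 4m′ darts (ordered adjacent pairs), and an edge poor if neither its
-- endpoints nor its colour are rich. Take a maximal rainbow matching M of poor edges, with k
-- edges, and let p and q be the numbers of rich vertices and rich colours. Since c is proper,
-- the total colour degree is at most the number of darts, and by maximality every dart has a
-- rich endpoint, a rich colour, an endpoint in M or a colour of M; counting these with n ≥ 8m
-- gives fewer than 2mn darts unless k + q + p ≥ m. In that case M grows to m edges greedily:
-- first by one edge of each of several rich colours, avoiding M and the rich vertices held in
-- reserve (at most 2m′ vertices, each meeting at most one of the more than 2m′ edges of that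
-- colour), then by one edge at each reserved rich vertex, whose more than 3m′ neighbours carry
-- distinct colours, avoiding the vertices and colours already in use.

module Submission where

open import Defs
open import Data.Bool using (T)
open import Data.Empty using (⊥-elim)
open import Data.Fin using (Fin) renaming (_≟_ to _≟ᶠ_)
open import Data.Fin.Properties using (any?)
open import Data.List using (List; []; _∷_; map; filter; length; allFin; _++_; take; drop; cartesianProduct; deduplicate)
open import Data.List.Properties using (length-tabulate; length-map; length-deduplicate; length-++; length-drop; length-take; length-removeAt′)
open import Data.List.Membership.Propositional using (_∈_; _∉_)
open import Data.List.Membership.Propositional.Properties using (∈-allFin; ∈-filter⁺; ∈-filter⁻; ∈-map⁺; ∈-++⁺ˡ; ∈-++⁺ʳ; ∈-cartesianProduct⁺; ∈-deduplicate⁺)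
import Data.List.Membership.DecPropositional as DecMembership
open import Data.List.Relation.Unary.All using (All; []; _∷_)
import Data.List.Relation.Unary.All as All
open import Data.List.Relation.Unary.All.Properties.Core using (¬Any⇒All¬)
open import Data.List.Relation.Unary.All.Properties as All using (all-filter; deduplicate⁺)
open import Data.List.Relation.Unary.Any using (here; there; _─_)
open import Data.List.Relation.Unary.AllPairs using ([]; _∷_)
open import Data.List.Relation.Unary.Unique.Propositional using (Unique)
open import Data.List.Relation.Unary.Unique.Propositional.Properties as Unique using (allFin⁺; filter⁺)
open import Data.Nat using (ℕ; zero; suc; _+_; _*_; _∸_; _≤_; _<_; _≤?_; _<?_; z≤n; s≤s) renaming (_≟_ to _≟ⁿ_)
open import Data.List.Relation.Unary.Unique.DecPropositional.Properties Data.Nat._≟_ using (deduplicate-!)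
open import Data.Nat.ListAction using (sum)
open import Data.Nat.Properties
open import Algebra.Properties.CommutativeSemigroup +-commutativeSemigroup using (interchange)
open import Data.Nat.Tactic.RingSolver using (solve-∀)
open import Data.Product using (Σ; Σ-syntax; ∃-syntax; ∃₂; _×_; _,_; proj₁; proj₂; uncurry)
open import Data.Sum using (_⊎_; inj₁; inj₂)
open import Function using (_∘_)
open import Relation.Binary.PropositionalEquality
open import Relation.Nullary using (Dec; yes; no; ¬_)
open import Relation.Nullary.Decidable using (T?; _×-dec_; _⊎-dec_; ¬?)
open import Relation.Unary using (Pred; Decidable)

𝟙 : ∀ {p} {P : Set p} → Dec P → ℕ
𝟙 (yes _) = 1
𝟙 (no _)  = 0

module _ {a} {A : Set a} where

  ∑ : List A → (A → ℕ) → ℕ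
  ∑ xs f = sum (map f xs)

  syntax ∑ xs (λ x → e) = ∑[ x ∈ xs ] e

  ∑-cong : ∀ xs {f g : A → ℕ} → (∀ x → f x ≡ g x) → ∑ xs f ≡ ∑ xs g
  ∑-cong []       f≡g = refl
  ∑-cong (x ∷ xs) f≡g = cong₂ _+_ (f≡g x) (∑-cong xs f≡g)

  ∑-mono-≤ : ∀ xs {f g : A → ℕ} → (∀ x → f x ≤ g x) → ∑ xs f ≤ ∑ xs g
  ∑-mono-≤ []       f≤g = z≤n
  ∑-mono-≤ (x ∷ xs) f≤g = +-mono-≤ (f≤g x) (∑-mono-≤ xs f≤g)

  ∑-distrib-+ : ∀ xs (f g : A → ℕ) → ∑[ x ∈ xs ] (f x + g x) ≡ ∑ xs f + ∑ xs g
  ∑-distrib-+ []       f g = refl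
  ∑-distrib-+ (x ∷ xs) f g =
    trans (cong (f x + g x +_) (∑-distrib-+ xs f g)) (interchange (f x) (g x) _ _)

  ∑-distribˡ-* : ∀ xs k (f : A → ℕ) → ∑[ x ∈ xs ] (k * f x) ≡ k * ∑ xs f
  ∑-distribˡ-* []       k f = sym (*-zeroʳ k)
  ∑-distribˡ-* (x ∷ xs) k f =
    trans (cong (k * f x +_) (∑-distribˡ-* xs k f)) (sym (*-distribˡ-+ k (f x) (∑ xs f)))

  ∑-distribʳ-* : ∀ xs k (f : A → ℕ) → ∑[ x ∈ xs ] (f x * k) ≡ ∑ xs f * k
  ∑-distribʳ-* xs k f = begin
    ∑[ x ∈ xs ] (f x * k) ≡⟨ ∑-cong xs (λ x → *-comm (f x) k) ⟩
    ∑[ x ∈ xs ] (k * f x) ≡⟨ ∑-distribˡ-* xs k f ⟩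
    k * ∑ xs f            ≡⟨ *-comm k (∑ xs f) ⟩
    ∑ xs f * k            ∎
    where open ≡-Reasoning

  ∑-const : ∀ xs k → ∑[ x ∈ xs ] k ≡ length xs * k
  ∑-const []       k = refl
  ∑-const (x ∷ xs) k = cong (k +_) (∑-const xs k)

  ∑-zero : ∀ xs → ∑[ x ∈ xs ] 0 ≡ 0
  ∑-zero xs = trans (∑-const xs 0) (*-zeroʳ (length xs))

  ∑𝟙≡length-filter : ∀ {p} {P : Pred A p} (P? : Decidable P) xs →
                     ∑[ x ∈ xs ] 𝟙 (P? x) ≡ length (filter P? xs)
  ∑𝟙≡length-filter P? []       = refl
  ∑𝟙≡length-filter P? (x ∷ xs) with P? x
  ... | yes _ = cong suc (∑𝟙≡length-filter P? xs)
  ... | no  _ = ∑𝟙≡length-filter P? xs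

∑-comm : ∀ {a b} {A : Set a} {B : Set b} xs ys (f : A → B → ℕ) →
         ∑[ x ∈ xs ] ∑[ y ∈ ys ] f x y ≡ ∑[ y ∈ ys ] ∑[ x ∈ xs ] f x y
∑-comm []       ys f = sym (∑-zero ys)
∑-comm (x ∷ xs) ys f =
  trans (cong (∑ ys (f x) +_) (∑-comm xs ys f)) (sym (∑-distrib-+ ys (f x) _))

∑∑-distrib-+ : ∀ {a b} {A : Set a} {B : Set b} xs ys (f g : A → B → ℕ) →
  ∑[ x ∈ xs ] ∑[ y ∈ ys ] (f x y + g x y) ≡
  ∑[ x ∈ xs ] ∑[ y ∈ ys ] f x y + ∑[ x ∈ xs ] ∑[ y ∈ ys ] g x y
∑∑-distrib-+ xs ys f g =
  trans (∑-cong xs (λ x → ∑-distrib-+ ys (f x) (g x))) (∑-distrib-+ xs _ _)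

module _ {a b} {A : Set a} {B : Set b} where

  ∈-─ : ∀ {x y : B} {ys} (x∈ys : x ∈ ys) → y ∈ ys → y ≢ x → y ∈ (ys ─ x∈ys)
  ∈-─ (here refl) (here refl) y≢x = ⊥-elim (y≢x refl)
  ∈-─ (here _)    (there y∈)  _   = y∈
  ∈-─ (there _)   (here y≡)   _   = here y≡
  ∈-─ (there x∈)  (there y∈)  y≢x = there (∈-─ x∈ y∈ y≢x)

  length-≤-by-injection : ∀ (f : A → B) {xs ys} → Unique xs →
    (∀ {x y} → x ∈ xs → y ∈ xs → f x ≡ f y → x ≡ y) →
    (∀ {x} → x ∈ xs → f x ∈ ys) → length xs ≤ length ys
  length-≤-by-injection f {[]}     _            _   _    = z≤n
  length-≤-by-injection f {x ∷ xs} {ys} (x∉xs ∷ u) inj into =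
    subst (suc (length xs) ≤_) (sym (length-removeAt′ ys _))
      (s≤s (length-≤-by-injection f u (λ p q → inj (there p) (there q)) into-rest))
    where
    into-rest : ∀ {y} → y ∈ xs → f y ∈ (ys ─ into (here refl))
    into-rest y∈xs = ∈-─ (into (here refl)) (into (there y∈xs))
      (λ fy≡fx → All.lookup x∉xs y∈xs (sym (inj (there y∈xs) (here refl) fy≡fx)))

length-take-≤ : ∀ {a} {A : Set a} {i} {xs : List A} → i ≤ length xs → length (take i xs) ≡ i
length-take-≤ {i = i} {xs} i≤ = trans (length-take i xs) (m≤n⇒m⊓n≡m i≤)

degree-count-too-small : ∀ {m′ n k q p} → 8 * suc m′ ≤ n → k + q + p ≤ m′ →
  n * p + (n * p + (n * q + (2 * k * (3 * m′) + (2 * k * (3 * m′) + k * (4 * m′)))))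
    < 2 * suc m′ * n
degree-count-too-small {m′} {n} {k} {q} {p} 8m≤n k+q+p≤m′ = begin-strict
  n * p + (n * p + (n * q + (2 * k * (3 * m′) + (2 * k * (3 * m′) + k * (4 * m′)))))
    ≡⟨ regroup m′ n k q p ⟩
  (p + p + q) * n + k * (2 * (8 * m′))
    ≤⟨ +-monoʳ-≤ ((p + p + q) * n) (*-monoʳ-≤ k (*-monoʳ-≤ 2 8m′≤n)) ⟩
  (p + p + q) * n + k * (2 * n)
    ≤⟨ m≤m+n _ (q * n) ⟩
  (p + p + q) * n + k * (2 * n) + q * n
    ≡⟨ regroup′ n k q p ⟩
  2 * (k + q + p) * n
    ≤⟨ *-monoˡ-≤ n (*-monoʳ-≤ 2 k+q+p≤m′) ⟩
  2 * m′ * n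
    <⟨ m<m+n (2 * m′ * n) 0<2n ⟩
  2 * m′ * n + 2 * n
    ≡⟨ regroup″ m′ n ⟩
  2 * suc m′ * n ∎
  where
  open ≤-Reasoning
  8m′≤n : 8 * m′ ≤ n
  8m′≤n = ≤-trans (*-monoʳ-≤ 8 (n≤1+n m′)) 8m≤n
  0<2n : 0 < 2 * n
  0<2n = ≤-trans (≤-trans (s≤s z≤n) 8m≤n) (m≤m+n n (n + 0))
  regroup : ∀ m′ n k q p →
    n * p + (n * p + (n * q + (2 * k * (3 * m′) + (2 * k * (3 * m′) + k * (4 * m′)))))
      ≡ (p + p + q) * n + k * (2 * (8 * m′))
  regroup = solve-∀
  regroup′ : ∀ n k q p → (p + p + q) * n + k * (2 * n) + q * n ≡ 2 * (k + q + p) * n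
  regroup′ = solve-∀
  regroup″ : ∀ m′ n → 2 * m′ * n + 2 * n ≡ 2 * suc m′ * n
  regroup″ = solve-∀

budget-split : ∀ {k m a b} → k ≤ m → m ≤ k + a + b → ∃₂ λ i j → i ≤ a × j ≤ b × k + i + j ≡ m
budget-split {k} {m} {a} {b} k≤m m≤k+a+b with m ≤? k + a
... | yes m≤k+a = m ∸ k , 0 , m≤n+o⇒m∸n≤o m k m≤k+a , z≤n , trans (+-identityʳ _) (m+[n∸m]≡n k≤m)
... | no  m≰k+a = a , m ∸ (k + a) , ≤-refl , m≤n+o⇒m∸n≤o m (k + a) m≤k+a+b , m+[n∸m]≡n (<⇒≤ (≰⇒> m≰k+a))

room-for-colour : ∀ {k a r m′} → k + suc a + r ≡ suc m′ → 2 * (2 * k + r) ≤ 4 * m′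
room-for-colour {k} {a} {r} {m′} size = begin
  2 * (2 * k + r)         ≤⟨ m≤m+n (2 * (2 * k + r)) (2 * r) ⟩
  2 * (2 * k + r) + 2 * r ≡⟨ regroup k r ⟩
  4 * (k + r)             ≤⟨ *-monoʳ-≤ 4 (≤-trans (m≤m+n (k + r) a) (≤-reflexive k+r+a≡m′)) ⟩
  4 * m′                  ∎
  where
  open ≤-Reasoning
  regroup : ∀ k r → 2 * (2 * k + r) + 2 * r ≡ 4 * (k + r)
  regroup = solve-∀
  shuffle : ∀ k a r → k + suc a + r ≡ suc (k + r + a)
  shuffle = solve-∀
  k+r+a≡m′ : k + r + a ≡ m′
  k+r+a≡m′ = suc-injective (trans (sym (shuffle k a r)) size)

room-for-vertex : ∀ {k l m′} → k + suc l ≡ suc m′ → 2 * k + l + k ≤ 3 * m′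
room-for-vertex {k} {l} {m′} size = begin
  2 * k + l + k           ≤⟨ m≤m+n (2 * k + l + k) (2 * l) ⟩
  2 * k + l + k + 2 * l   ≡⟨ regroup k l ⟩
  3 * (k + l)             ≡⟨ cong (3 *_) (suc-injective (trans (sym (+-suc k l)) size)) ⟩
  3 * m′                  ∎
  where
  open ≤-Reasoning
  regroup : ∀ k l → 2 * k + l + k + 2 * l ≡ 3 * (k + l)
  regroup = solve-∀

module Colouring {n : ℕ} (G : Graph n) (c : Coloring n)
                 (symmetric : IsEdgeColoring G c) (proper : IsProper G c) where

  open DecMembership (_≟ᶠ_ {n}) using () renaming (_∈?_ to _∈ᵛ?_)
  open DecMembership _≟ⁿ_ using () renaming (_∈?_ to _∈ᶜ?_)

  Vertex : Set
  Vertex = Fin n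

  Edge : Set
  Edge = Vertex × Vertex

  vertices : List Vertex
  vertices = allFin n

  length-vertices : length vertices ≡ n
  length-vertices = length-tabulate (λ v → v)

  allPairs : List Edge
  allPairs = cartesianProduct vertices vertices

  ∈-allPairs : ∀ v u → (v , u) ∈ allPairs
  ∈-allPairs v u = ∈-cartesianProduct⁺ (∈-allFin v) (∈-allFin u)

  _~_ : Vertex → Vertex → Set
  v ~ u = T (adj G v u)

  _~?_ : ∀ v u → Dec (v ~ u)
  v ~? u = T? (adj G v u)

  ~-sym : ∀ {v u} → v ~ u → u ~ v
  ~-sym {v} {u} = subst T (adj-sym G v u)

  ~-irrefl : ∀ {v u} → v ~ u → v ≢ u
  ~-irrefl {v} v~v refl rewrite adj-irrefl G v = v~v

  deg : Vertex → ℕ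
  deg v = length (nbrs G v)

  deg≡∑ : ∀ v → deg v ≡ ∑[ u ∈ vertices ] 𝟙 (v ~? u)
  deg≡∑ v = sym (∑𝟙≡length-filter (v ~?_) vertices)

  ∑² : (Vertex → Vertex → ℕ) → ℕ
  ∑² f = ∑[ v ∈ vertices ] ∑[ u ∈ vertices ] f v u

  ∑²-mono-≤ : ∀ {f g : Vertex → Vertex → ℕ} → (∀ v u → f v u ≤ g v u) → ∑² f ≤ ∑² g
  ∑²-mono-≤ f≤g = ∑-mono-≤ vertices (λ v → ∑-mono-≤ vertices (f≤g v))

  ∑²-+-≤ : ∀ {f g : Vertex → Vertex → ℕ} {F H} → ∑² f ≤ F → ∑² g ≤ H →
           ∑² (λ v u → f v u + g v u) ≤ F + H
  ∑²-+-≤ {f} {g} f≤ g≤ = ≤-trans (≤-reflexive (∑∑-distrib-+ vertices vertices f g)) (+-mono-≤ f≤ g≤)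

  totalColorDegree≤∑deg : totalColorDegree G c ≤ ∑ vertices deg
  totalColorDegree≤∑deg = ∑-mono-≤ vertices λ v →
    ≤-trans (length-deduplicate _≟ⁿ_ (map (c v) (nbrs G v))) (≤-reflexive (length-map (c v) (nbrs G v)))

  colour-injective : ∀ {v x y} → v ~ x → v ~ y → c v x ≡ c v y → x ≡ y
  colour-injective {v} {x} {y} v~x v~y cx≡cy with x ≟ᶠ y
  ... | yes x≡y = x≡y
  ... | no  x≢y = ⊥-elim (proper v x y v~x v~y x≢y cx≡cy)

  ∑𝟙∈≤length : ∀ (X : List Vertex) → ∑[ u ∈ vertices ] 𝟙 (u ∈ᵛ? X) ≤ length X
  ∑𝟙∈≤length X = begin
    ∑[ u ∈ vertices ] 𝟙 (u ∈ᵛ? X) ≡⟨ ∑𝟙≡length-filter (_∈ᵛ? X) vertices ⟩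
    length (filter (_∈ᵛ? X) vertices)
      ≤⟨ length-≤-by-injection (λ u → u) (filter⁺ (_∈ᵛ? X) (allFin⁺ n)) (λ _ _ eq → eq)
           (λ u∈ → proj₂ (∈-filter⁻ (_∈ᵛ? X) {xs = vertices} u∈)) ⟩
    length X                       ∎
    where open ≤-Reasoning

  ∑𝟙-colour≤length : ∀ v {p} {P : Pred ℕ p} (P? : Decidable P) (Y : List ℕ) →
    (∀ {u} → v ~ u → P (c v u) → c v u ∈ Y) →
    ∑[ u ∈ vertices ] 𝟙 (v ~? u ×-dec P? (c v u)) ≤ length Y
  ∑𝟙-colour≤length v {P = P} P? Y P⇒∈Y = begin
    ∑[ u ∈ vertices ] 𝟙 (Q? u) ≡⟨ ∑𝟙≡length-filter Q? vertices ⟩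
    length (filter Q? vertices)
      ≤⟨ length-≤-by-injection (c v) (filter⁺ Q? (allFin⁺ n))
           (λ x∈ y∈ → colour-injective (proj₁ (Q-of x∈)) (proj₁ (Q-of y∈)))
           (λ u∈ → P⇒∈Y (proj₁ (Q-of u∈)) (proj₂ (Q-of u∈))) ⟩
    length Y                    ∎
    where
    open ≤-Reasoning
    Q? : ∀ u → Dec (v ~ u × P (c v u))
    Q? u = v ~? u ×-dec P? (c v u)
    Q-of : ∀ {u} → u ∈ filter Q? vertices → v ~ u × P (c v u)
    Q-of u∈ = proj₂ (∈-filter⁻ Q? {xs = vertices} u∈)

  ∑²-rows-in≤ : ∀ (X : List Vertex) (f : Vertex → Vertex → ℕ) b →
    (∀ {v} → v ∈ X → ∑[ u ∈ vertices ] f v u ≤ b) →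
    ∑² (λ v u → 𝟙 (v ∈ᵛ? X) * f v u) ≤ length X * b
  ∑²-rows-in≤ X f b row≤b = begin
    ∑² (λ v u → 𝟙 (v ∈ᵛ? X) * f v u)
      ≡⟨ ∑-cong vertices (λ v → ∑-distribˡ-* vertices (𝟙 (v ∈ᵛ? X)) (f v)) ⟩
    ∑[ v ∈ vertices ] (𝟙 (v ∈ᵛ? X) * ∑ vertices (f v))
      ≤⟨ ∑-mono-≤ vertices row≤ ⟩
    ∑[ v ∈ vertices ] (𝟙 (v ∈ᵛ? X) * b)
      ≡⟨ ∑-distribʳ-* vertices b (λ v → 𝟙 (v ∈ᵛ? X)) ⟩
    ∑[ v ∈ vertices ] 𝟙 (v ∈ᵛ? X) * b
      ≤⟨ *-monoˡ-≤ b (∑𝟙∈≤length X) ⟩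
    length X * b ∎
    where
    open ≤-Reasoning
    row≤ : ∀ v → 𝟙 (v ∈ᵛ? X) * ∑ vertices (f v) ≤ 𝟙 (v ∈ᵛ? X) * b
    row≤ v with v ∈ᵛ? X
    ... | yes v∈X = +-monoˡ-≤ 0 (row≤b v∈X)
    ... | no  _   = z≤n

  ∑²-tail : ∀ {p} {P : Pred Vertex p} (P? : Decidable P) →
    ∑² (λ v u → 𝟙 (P? v)) ≡ n * length (filter P? vertices)
  ∑²-tail P? = begin
    ∑[ v ∈ vertices ] ∑[ u ∈ vertices ] 𝟙 (P? v)
      ≡⟨ ∑-cong vertices (λ v → ∑-const vertices (𝟙 (P? v))) ⟩
    ∑[ v ∈ vertices ] (length vertices * 𝟙 (P? v))
      ≡⟨ ∑-distribˡ-* vertices (length vertices) (λ v → 𝟙 (P? v)) ⟩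
    length vertices * ∑[ v ∈ vertices ] 𝟙 (P? v)
      ≡⟨ cong₂ _*_ length-vertices (∑𝟙≡length-filter P? vertices) ⟩
    n * length (filter P? vertices) ∎
    where open ≡-Reasoning

  ∑²-head : ∀ {p} {P : Pred Vertex p} (P? : Decidable P) →
    ∑² (λ v u → 𝟙 (P? u)) ≡ n * length (filter P? vertices)
  ∑²-head P? = trans (∑-comm vertices vertices (λ v u → 𝟙 (P? u))) (∑²-tail P?)

  ∑²-leaving≤ : ∀ (X : List Vertex) b → (∀ {v} → v ∈ X → deg v ≤ b) →
    ∑² (λ v u → 𝟙 (v ∈ᵛ? X) * 𝟙 (v ~? u)) ≤ length X * b
  ∑²-leaving≤ X b deg≤b =
    ∑²-rows-in≤ X (λ v u → 𝟙 (v ~? u)) b (λ {v} v∈X → subst (_≤ b) (deg≡∑ v) (deg≤b v∈X))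

  ∑²-entering≤ : ∀ (X : List Vertex) b → (∀ {v} → v ∈ X → deg v ≤ b) →
    ∑² (λ v u → 𝟙 (u ∈ᵛ? X) * 𝟙 (u ~? v)) ≤ length X * b
  ∑²-entering≤ X b deg≤b =
    ≤-trans (≤-reflexive (∑-comm vertices vertices _)) (∑²-leaving≤ X b deg≤b)

  Dart : ℕ → Vertex → Vertex → Set
  Dart α v u = v ~ u × c v u ≡ α

  Dart? : ∀ α v u → Dec (Dart α v u)
  Dart? α v u = v ~? u ×-dec c v u ≟ⁿ α

  darts : ℕ → ℕ
  darts α = ∑² (λ v u → 𝟙 (Dart? α v u))

  Dart-sym : ∀ {α v u} → Dart α v u → Dart α u v
  Dart-sym {v = v} {u} (v~u , cvu≡α) = ~-sym v~u , trans (sym (symmetric v u v~u)) cvu≡α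

  ∑𝟙Dart≤1 : ∀ α v → ∑[ u ∈ vertices ] 𝟙 (Dart? α v u) ≤ 1
  ∑𝟙Dart≤1 α v = ∑𝟙-colour≤length v (_≟ⁿ α) (α ∷ []) (λ _ cvu≡α → here cvu≡α)

  ∑²-colour-in≤ : ∀ (Y : List ℕ) D → All (λ α → darts α ≤ D) Y →
    ∑² (λ v u → 𝟙 (v ~? u ×-dec c v u ∈ᶜ? Y)) ≤ length Y * D
  ∑²-colour-in≤ [] D [] = ≤-trans (∑²-mono-≤ none)
    (≤-reflexive (trans (∑-cong vertices (λ _ → ∑-zero vertices)) (∑-zero vertices)))
    where
    none : ∀ v u → 𝟙 (v ~? u ×-dec c v u ∈ᶜ? []) ≤ 0
    none v u with v ~? u | c v u ∈ᶜ? []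
    ... | no _  | _      = z≤n
    ... | yes _ | no _   = z≤n
    ... | yes _ | yes ()
  ∑²-colour-in≤ (α ∷ Y) D (darts≤D ∷ Y≤D) =
    ≤-trans (∑²-mono-≤ split) (∑²-+-≤ darts≤D (∑²-colour-in≤ Y D Y≤D))
    where
    split : ∀ v u → 𝟙 (v ~? u ×-dec c v u ∈ᶜ? (α ∷ Y))
                  ≤ 𝟙 (Dart? α v u) + 𝟙 (v ~? u ×-dec c v u ∈ᶜ? Y)
    split v u with v ~? u | c v u ≟ⁿ α | c v u ∈ᶜ? Y
    ... | no _  | _     | _     = z≤n
    ... | yes _ | yes _ | _     = s≤s z≤n
    ... | yes _ | no _  | yes _ = s≤s z≤n
    ... | yes _ | no _  | no _  = z≤n

  colours : List Edge → List ℕ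
  colours M = map (λ e → c (proj₁ e) (proj₂ e)) M

  length-endpoints : ∀ (M : List Edge) → length (endpoints M) ≡ 2 * length M
  length-endpoints []      = refl
  length-endpoints (_ ∷ M) = cong suc (trans (cong suc (length-endpoints M))
                                             (sym (+-suc (length M) (length M + 0))))

  rainbow-∷ : ∀ {M v u} → IsRainbowMatching G c M → v ~ u →
    v ∉ endpoints M → u ∉ endpoints M → c v u ∉ colours M →
    IsRainbowMatching G c ((v , u) ∷ M)
  rainbow-∷ {M} (edges , distinct-ends , distinct-colours) v~u v∉ u∉ cvu∉ =
    v~u ∷ edges ,
    (~-irrefl v~u ∷ ¬Any⇒All¬ (endpoints M) v∉) ∷ ¬Any⇒All¬ (endpoints M) u∉ ∷ distinct-ends ,
    ¬Any⇒All¬ (colours M) cvu∉ ∷ distinct-colours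

  rainbow-drop : ∀ k {M} → IsRainbowMatching G c M → IsRainbowMatching G c (drop k M)
  rainbow-drop zero    rm = rm
  rainbow-drop (suc k) {[]} rm = rm
  rainbow-drop (suc k) {_ ∷ M} (_ ∷ edges , _ ∷ _ ∷ distinct-ends , _ ∷ distinct-colours) =
    rainbow-drop k (edges , distinct-ends , distinct-colours)

  Blocked : List Edge → Edge → Set
  Blocked M (v , u) = v ∈ endpoints M ⊎ u ∈ endpoints M ⊎ c v u ∈ colours M

  Blocked? : ∀ M e → Dec (Blocked M e)
  Blocked? M (v , u) = v ∈ᵛ? endpoints M ⊎-dec (u ∈ᵛ? endpoints M ⊎-dec c v u ∈ᶜ? colours M)

  Blocked-∷ : ∀ {M e} e′ → Blocked M e → Blocked (e′ ∷ M) e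
  Blocked-∷ _ (inj₁ v∈)        = inj₁ (there (there v∈))
  Blocked-∷ _ (inj₂ (inj₁ u∈)) = inj₂ (inj₁ (there (there u∈)))
  Blocked-∷ _ (inj₂ (inj₂ c∈)) = inj₂ (inj₂ (there c∈))

  module _ {s} {S : Pred Edge s} (S? : Decidable S) (S⇒~ : ∀ {v u} → S (v , u) → v ~ u) where

    greedy-rainbow-matching : ∀ es → Σ[ M ∈ List Edge ]
      IsRainbowMatching G c M × All S M × (∀ {e} → e ∈ es → S e → Blocked M e)
    greedy-rainbow-matching [] = [] , ([] , [] , []) , [] , λ ()
    greedy-rainbow-matching (e ∷ es) with greedy-rainbow-matching es
    ... | M , rm , SM , covered with S? e | Blocked? M e
    ... | no ¬Se | _ = M , rm , SM , λ where
      (here refl) Se → ⊥-elim (¬Se Se)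
      (there e∈)  Se → covered e∈ Se
    ... | yes _ | yes blocked = M , rm , SM , λ where
      (here refl) _ → blocked
      (there e∈)  Se → covered e∈ Se
    ... | yes Se | no ¬blocked =
      e ∷ M ,
      rainbow-∷ rm (S⇒~ Se) (¬blocked ∘ inj₁) (¬blocked ∘ inj₂ ∘ inj₁) (¬blocked ∘ inj₂ ∘ inj₂) ,
      Se ∷ SM ,
      λ where
        (here refl) _ → inj₁ (here refl)
        (there e∈)  Se′ → Blocked-∷ e (covered e∈ Se′)

    maximal-rainbow-matching : Σ[ M ∈ List Edge ]
      IsRainbowMatching G c M × All S M × (∀ e → S e → Blocked M e)
    maximal-rainbow-matching with greedy-rainbow-matching allPairs
    ... | M , rm , SM , covered = M , rm , SM , λ (v , u) → covered (∈-allPairs v u)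

  edge-of-colour-avoiding : ∀ α (X : List Vertex) → 2 * length X < darts α →
    ∃[ v ] ∃[ u ] Dart α v u × v ∉ X × u ∉ X
  edge-of-colour-avoiding α X X-small
    with any? (λ v → any? (λ u → Dart? α v u ×-dec ¬? (v ∈ᵛ? X) ×-dec ¬? (u ∈ᵛ? X)))
  ... | yes (v , u , dart , v∉X , u∉X) = v , u , dart , v∉X , u∉X
  ... | no none = ⊥-elim (<⇒≱ X-small darts≤2|X|)
    where
    outgoing incoming : Vertex → Vertex → ℕ
    outgoing v u = 𝟙 (v ∈ᵛ? X) * 𝟙 (Dart? α v u)
    incoming v u = 𝟙 (u ∈ᵛ? X) * 𝟙 (Dart? α u v)

    dart-meets-X : ∀ v u → 𝟙 (Dart? α v u) ≤ outgoing v u + incoming v u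
    dart-meets-X v u with Dart? α v u | Dart? α u v | v ∈ᵛ? X | u ∈ᵛ? X
    ... | no _    | _       | _     | _     = z≤n
    ... | yes _   | _       | yes _ | _     = s≤s z≤n
    ... | yes _   | yes _   | no _  | yes _ = s≤s z≤n
    ... | yes d   | no ¬d   | no _  | yes _ = ⊥-elim (¬d (Dart-sym d))
    ... | yes d   | _       | no v∉ | no u∉ = ⊥-elim (none (v , u , d , v∉ , u∉))

    darts≤2|X| : darts α ≤ 2 * length X
    darts≤2|X| = begin
      darts α                                     ≤⟨ ∑²-mono-≤ dart-meets-X ⟩
      ∑² (λ v u → outgoing v u + incoming v u)   ≤⟨ ∑²-+-≤ out≤|X| in≤|X| ⟩
      length X * 1 + length X * 1                 ≡⟨ double (length X) ⟩
      2 * length X                                ∎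
      where
      open ≤-Reasoning
      out≤|X| : ∑² outgoing ≤ length X * 1
      out≤|X| = ∑²-rows-in≤ X (λ v u → 𝟙 (Dart? α v u)) 1 (λ {v} _ → ∑𝟙Dart≤1 α v)
      in≤|X| : ∑² incoming ≤ length X * 1
      in≤|X| = ≤-trans (≤-reflexive (∑-comm vertices vertices incoming)) out≤|X|
      double : ∀ x → x * 1 + x * 1 ≡ 2 * x
      double = solve-∀

  neighbour-avoiding : ∀ b (X : List Vertex) (Y : List ℕ) → length X + length Y < deg b →
    ∃[ u ] b ~ u × u ∉ X × c b u ∉ Y
  neighbour-avoiding b X Y XY-small
    with any? (λ u → b ~? u ×-dec ¬? (u ∈ᵛ? X) ×-dec ¬? (c b u ∈ᶜ? Y))
  ... | yes found = found
  ... | no none = ⊥-elim (<⇒≱ XY-small deg≤|X|+|Y|)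
    where
    neighbour-excluded : ∀ u → 𝟙 (b ~? u) ≤ 𝟙 (u ∈ᵛ? X) + 𝟙 (b ~? u ×-dec c b u ∈ᶜ? Y)
    neighbour-excluded u with b ~? u | u ∈ᵛ? X | c b u ∈ᶜ? Y
    ... | no _    | _     | _     = z≤n
    ... | yes _   | yes _ | _     = s≤s z≤n
    ... | yes _   | no _  | yes _ = s≤s z≤n
    ... | yes b~u | no u∉ | no c∉ = ⊥-elim (none (u , b~u , u∉ , c∉))

    deg≤|X|+|Y| : deg b ≤ length X + length Y
    deg≤|X|+|Y| = begin
      deg b                           ≡⟨ deg≡∑ b ⟩
      ∑[ u ∈ vertices ] 𝟙 (b ~? u)   ≤⟨ ∑-mono-≤ vertices neighbour-excluded ⟩
      ∑[ u ∈ vertices ] (𝟙 (u ∈ᵛ? X) + 𝟙 (b ~? u ×-dec c b u ∈ᶜ? Y))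
        ≡⟨ ∑-distrib-+ vertices _ _ ⟩
      ∑[ u ∈ vertices ] 𝟙 (u ∈ᵛ? X) + ∑[ u ∈ vertices ] 𝟙 (b ~? u ×-dec c b u ∈ᶜ? Y)
        ≤⟨ +-mono-≤ (∑𝟙∈≤length X) (∑𝟙-colour≤length b (_∈ᶜ? Y) Y (λ _ c∈ → c∈)) ⟩
      length X + length Y             ∎
      where open ≤-Reasoning

  module Thresholds (d D : ℕ) where

    Rich : Vertex → Set
    Rich v = d < deg v

    Rich? : ∀ v → Dec (Rich v)
    Rich? v = d <? deg v

    RichColour : ℕ → Set
    RichColour α = D < darts α

    RichColour? : ∀ α → Dec (RichColour α)
    RichColour? α = D <? darts α

    PoorEdge : Edge → Set
    PoorEdge (v , u) = v ~ u × ¬ Rich v × ¬ Rich u × ¬ RichColour (c v u)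

    PoorEdge? : ∀ e → Dec (PoorEdge e)
    PoorEdge? (v , u) = v ~? u ×-dec ¬? (Rich? v) ×-dec ¬? (Rich? u) ×-dec ¬? (RichColour? (c v u))

    richVertices : List Vertex
    richVertices = filter Rich? vertices

    -- c is junk on non-adjacent pairs, but such a value only passes the filter if darts carry it.
    richColours : List ℕ
    richColours = deduplicate _≟ⁿ_ (filter RichColour? (map (uncurry c) allPairs))

    ∈-richColours : ∀ {v u} → RichColour (c v u) → c v u ∈ richColours
    ∈-richColours {v} {u} rich = ∈-deduplicate⁺ _≟ⁿ_ (∈-filter⁺ RichColour?
      (∈-map⁺ (uncurry c) (∈-allPairs v u)) rich)

    poor-endpoint : ∀ {M v} → All PoorEdge M → v ∈ endpoints M → ¬ Rich v
    poor-endpoint {(_ , _) ∷ _} (poor ∷ _) (here refl)         = proj₁ (proj₂ poor)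
    poor-endpoint {(_ , _) ∷ _} (poor ∷ _) (there (here refl)) = proj₁ (proj₂ (proj₂ poor))
    poor-endpoint {(_ , _) ∷ _} (_ ∷ poor) (there (there v∈))  = poor-endpoint poor v∈

    poor-colour : ∀ {M α} → All PoorEdge M → α ∈ colours M → ¬ RichColour α
    poor-colour {(_ , _) ∷ _} (poor ∷ _) (here refl) = proj₂ (proj₂ (proj₂ poor))
    poor-colour {(_ , _) ∷ _} (_ ∷ poor) (there α∈)  = poor-colour poor α∈

    richVertices-rich : All Rich richVertices
    richVertices-rich = all-filter Rich? vertices

    richVertices-unique : Unique richVertices
    richVertices-unique = filter⁺ Rich? (allFin⁺ n)

    richColours-rich : All RichColour richColours
    richColours-rich = deduplicate⁺ _≟ⁿ_ (all-filter RichColour? (map (uncurry c) allPairs))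

    richColours-unique : Unique richColours
    richColours-unique = deduplicate-! (filter RichColour? (map (uncurry c) allPairs))

    richVertices-unmatched : ∀ {M} → All PoorEdge M → All (_∉ endpoints M) richVertices
    richVertices-unmatched poor = All.map (λ rich v∈ → poor-endpoint poor v∈ rich) richVertices-rich

    richColours-unused : ∀ {M} → All PoorEdge M → All (_∉ colours M) richColours
    richColours-unused poor = All.map (λ rich α∈ → poor-colour poor α∈ rich) richColours-rich

    ∑²-rich-colour≤ : ∑² (λ v u → 𝟙 (v ~? u ×-dec RichColour? (c v u))) ≤ n * length richColours
    ∑²-rich-colour≤ = begin
      ∑² (λ v u → 𝟙 (v ~? u ×-dec RichColour? (c v u)))
        ≤⟨ ∑-mono-≤ vertices (λ v → ∑𝟙-colour≤length v RichColour? richColours (λ _ → ∈-richColours)) ⟩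
      ∑[ v ∈ vertices ] length richColours
        ≡⟨ ∑-const vertices (length richColours) ⟩
      length vertices * length richColours
        ≡⟨ cong (_* length richColours) length-vertices ⟩
      n * length richColours ∎
      where open ≤-Reasoning

    ∑deg≤ : ∀ {M} → All PoorEdge M → (∀ e → PoorEdge e → Blocked M e) →
      ∑ vertices deg ≤ n * length richVertices + (n * length richVertices + (n * length richColours
                       + (length (endpoints M) * d + (length (endpoints M) * d + length (colours M) * D))))
    ∑deg≤ {M} poor maximal = begin
      ∑ vertices deg                  ≡⟨ ∑-cong vertices deg≡∑ ⟩
      ∑² (λ v u → 𝟙 (v ~? u))        ≤⟨ ∑²-mono-≤ dart-classified ⟩
      ∑² (λ v u → from-rich v u + (to-rich v u + (rich-colour v u
                 + (from-E v u + (to-E v u + colour-in-Cl v u)))))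
        ≤⟨ ∑²-+-≤ (≤-reflexive (∑²-tail Rich?)) (∑²-+-≤ (≤-reflexive (∑²-head Rich?))
             (∑²-+-≤ ∑²-rich-colour≤ (∑²-+-≤ (∑²-leaving≤ E d poor-deg≤d)
               (∑²-+-≤ (∑²-entering≤ E d poor-deg≤d)
                 (∑²-colour-in≤ Cl D (All.tabulate (λ α∈ → ≮⇒≥ (poor-colour poor α∈)))))))) ⟩
      _ ∎
      where
      open ≤-Reasoning
      E : List Vertex
      E = endpoints M
      Cl : List ℕ
      Cl = colours M
      poor-deg≤d : ∀ {v} → v ∈ E → deg v ≤ d
      poor-deg≤d v∈E = ≮⇒≥ (poor-endpoint poor v∈E)

      from-rich to-rich rich-colour from-E to-E colour-in-Cl : Vertex → Vertex → ℕ
      from-rich v u = 𝟙 (Rich? v)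
      to-rich v u = 𝟙 (Rich? u)
      rich-colour v u = 𝟙 (v ~? u ×-dec RichColour? (c v u))
      from-E v u = 𝟙 (v ∈ᵛ? E) * 𝟙 (v ~? u)
      to-E v u = 𝟙 (u ∈ᵛ? E) * 𝟙 (u ~? v)
      colour-in-Cl v u = 𝟙 (v ~? u ×-dec c v u ∈ᶜ? Cl)

      -- A dart counted by none of the six terms would be a poor edge that is not blocked by M.
      dart-classified : ∀ v u → 𝟙 (v ~? u) ≤ from-rich v u + (to-rich v u + (rich-colour v u
                                   + (from-E v u + (to-E v u + colour-in-Cl v u))))
      dart-classified v u with v ~? u | Rich? v | Rich? u | RichColour? (c v u)
                             | v ∈ᵛ? E | u ∈ᵛ? E | u ~? v | c v u ∈ᶜ? Cl
      ... | no _    | _      | _      | _      | _     | _     | _       | _     = z≤n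
      ... | yes _   | yes _  | _      | _      | _     | _     | _       | _     = s≤s z≤n
      ... | yes _   | no _   | yes _  | _      | _     | _     | _       | _     = s≤s z≤n
      ... | yes _   | no _   | no _   | yes _  | _     | _     | _       | _     = s≤s z≤n
      ... | yes _   | no _   | no _   | no _   | yes _ | _     | _       | _     = s≤s z≤n
      ... | yes _   | no _   | no _   | no _   | no _  | yes _ | yes _   | _     = s≤s z≤n
      ... | yes v~u | no _   | no _   | no _   | no _  | yes _ | no ¬u~v | _     = ⊥-elim (¬u~v (~-sym v~u))
      ... | yes _   | no _   | no _   | no _   | no _  | no _  | _       | yes _ = s≤s z≤n
      ... | yes v~u | no ¬rv | no ¬ru | no ¬rc | no v∉ | no u∉ | _       | no c∉
        with maximal (v , u) (v~u , ¬rv , ¬ru , ¬rc)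
      ...   | inj₁ v∈        = ⊥-elim (v∉ v∈)
      ...   | inj₂ (inj₁ u∈) = ⊥-elim (u∉ u∈)
      ...   | inj₂ (inj₂ c∈) = ⊥-elim (c∉ c∈)

  module Completion (m′ : ℕ) where

    open Thresholds (3 * m′) (4 * m′)

    extend-by-colours : ∀ (αs : List ℕ) (reserved : List Vertex) {M} → IsRainbowMatching G c M →
      All RichColour αs → Unique αs → All (_∉ colours M) αs → All (_∉ endpoints M) reserved →
      length M + length αs + length reserved ≡ suc m′ →
      Σ[ M′ ∈ List Edge ] IsRainbowMatching G c M′ × All (_∉ endpoints M′) reserved
                          × length M′ + length reserved ≡ suc m′
    extend-by-colours [] reserved {M} rm _ _ _ free size =
      M , rm , free , trans (cong (_+ length reserved) (sym (+-identityʳ (length M)))) size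
    extend-by-colours (α ∷ αs) reserved {M} rm (rich ∷ richs) (α∉αs ∷ unique) (α∉M ∷ αs∉M) free size
      with edge-of-colour-avoiding α (endpoints M ++ reserved) (≤-<-trans room rich)
      where
      room : 2 * length (endpoints M ++ reserved) ≤ 4 * m′
      room = subst (λ x → 2 * x ≤ 4 * m′)
        (sym (trans (length-++ (endpoints M)) (cong (_+ length reserved) (length-endpoints M))))
        (room-for-colour {length M} {length αs} {length reserved} size)
    ... | v , u , (v~u , cvu≡α) , v∉ , u∉ =
      extend-by-colours αs reserved
        (rainbow-∷ rm v~u (v∉ ∘ ∈-++⁺ˡ) (u∉ ∘ ∈-++⁺ˡ) (α∉M ∘ subst (_∈ colours M) cvu≡α))
        richs unique αs∉M′ free′
        (trans (cong (_+ length reserved) (sym (+-suc (length M) (length αs)))) size)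
      where
      αs∉M′ : All (_∉ colours ((v , u) ∷ M)) αs
      αs∉M′ = All.zipWith (λ where
        (α≢β , β∉M) (here β≡cvu) → α≢β (trans (sym cvu≡α) (sym β≡cvu))
        (α≢β , β∉M) (there β∈M)  → β∉M β∈M) (α∉αs , αs∉M)
      free′ : All (_∉ endpoints ((v , u) ∷ M)) reserved
      free′ = All.tabulate λ where
        x∈res (here x≡v)          → v∉ (∈-++⁺ʳ (endpoints M) (subst (_∈ reserved) x≡v x∈res))
        x∈res (there (here x≡u))  → u∉ (∈-++⁺ʳ (endpoints M) (subst (_∈ reserved) x≡u x∈res))
        x∈res (there (there x∈M)) → All.lookup free x∈res x∈M

    extend-by-vertices : ∀ (bs : List Vertex) {M} → IsRainbowMatching G c M →
      All Rich bs → Unique bs → All (_∉ endpoints M) bs → length M + length bs ≡ suc m′ →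
      Σ[ M′ ∈ List Edge ] IsRainbowMatching G c M′ × length M′ ≡ suc m′
    extend-by-vertices [] {M} rm _ _ _ size = M , rm , trans (sym (+-identityʳ (length M))) size
    extend-by-vertices (b ∷ bs) {M} rm (rich ∷ richs) (b∉bs ∷ unique) (b∉M ∷ bs∉M) size
      with neighbour-avoiding b (endpoints M ++ bs) (colours M) (≤-<-trans room rich)
      where
      room : length (endpoints M ++ bs) + length (colours M) ≤ 3 * m′
      room = subst (_≤ 3 * m′)
                   (sym (cong₂ _+_ (trans (length-++ (endpoints M)) (cong (_+ length bs) (length-endpoints M)))
                                   (length-map _ M)))
                   (room-for-vertex {length M} {length bs} size)
    ... | u , b~u , u∉ , cbu∉ =
      extend-by-vertices bs (rainbow-∷ rm b~u b∉M (u∉ ∘ ∈-++⁺ˡ) cbu∉) richs unique bs∉M′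
        (trans (sym (+-suc (length M) (length bs))) size)
      where
      bs∉M′ : All (_∉ endpoints ((b , u) ∷ M)) bs
      bs∉M′ = All.tabulate λ where
        x∈bs (here x≡b)          → All.lookup b∉bs x∈bs (sym x≡b)
        x∈bs (there (here x≡u))  → u∉ (∈-++⁺ʳ (endpoints M) (subst (_∈ bs) x≡u x∈bs))
        x∈bs (there (there x∈M)) → All.lookup bs∉M x∈bs x∈M

    enough-rich : ∀ {M} → All PoorEdge M → (∀ e → PoorEdge e → Blocked M e) →
      8 * suc m′ ≤ n → 2 * suc m′ * n ≤ totalColorDegree G c →
      suc m′ ≤ length M + length richColours + length richVertices
    enough-rich {M} poor maximal 8m≤n 2mn≤total
      with suc m′ ≤? length M + length richColours + length richVertices
    ... | yes enough = enough
    ... | no  short  = ⊥-elim (<⇒≱ (degree-count-too-small 8m≤n (≤-pred (≰⇒> short)))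
                                    (≤-trans 2mn≤total (≤-trans totalColorDegree≤∑deg counted)))
      where
      counted : ∑ vertices deg ≤ n * length richVertices + (n * length richVertices
                  + (n * length richColours + (2 * length M * (3 * m′)
                  + (2 * length M * (3 * m′) + length M * (4 * m′)))))
      counted = subst₂ (λ e l → ∑ vertices deg ≤ n * length richVertices + (n * length richVertices
                          + (n * length richColours + (e * (3 * m′) + (e * (3 * m′) + l * (4 * m′))))))
                       (length-endpoints M) (length-map _ M) (∑deg≤ poor maximal)

    complete : ∀ {M} → IsRainbowMatching G c M → All PoorEdge M →
      suc m′ ≤ length M + length richColours + length richVertices →
      Σ[ M′ ∈ List Edge ] IsRainbowMatching G c M′ × length M′ ≡ suc m′
    complete {M} rm poor enough with suc m′ ≤? length M
    ... | yes m≤k = drop surplus M , rainbow-drop surplus rm ,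
                    trans (length-drop surplus M) (m∸[m∸n]≡n m≤k)
      where
      surplus : ℕ
      surplus = length M ∸ suc m′
    ... | no  m≰k with budget-split (<⇒≤ (≰⇒> m≰k)) enough
    ... | i , j , i≤q , j≤p , size
      with extend-by-colours (take i richColours) (take j richVertices) rm
             (All.take⁺ i richColours-rich) (Unique.take⁺ i richColours-unique)
             (All.take⁺ i (richColours-unused poor)) (All.take⁺ j (richVertices-unmatched poor))
             (trans (cong₂ (λ a b → length M + a + b) (length-take-≤ i≤q) (length-take-≤ j≤p)) size)
    ... | M′ , rm′ , free , size′ =
      extend-by-vertices (take j richVertices) rm′
        (All.take⁺ j richVertices-rich) (Unique.take⁺ j richVertices-unique) free size′

theorem3 : (m n : ℕ) (G : Graph n) (c : Coloring n)
    → IsEdgeColoring G c → IsProper G c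
    → 8 * m ≤ n
    → 2 * m * n ≤ totalColorDegree G c
    → Σ (List (Fin n × Fin n)) (λ M → IsRainbowMatching G c M × length M ≡ m)
theorem3 zero     n G c _         _      _    _         = [] , ([] , [] , []) , refl
theorem3 (suc m′) n G c symmetric proper 8m≤n 2mn≤total =
  let M , rm , poor , maximal = maximal-rainbow-matching PoorEdge? proj₁
  in complete rm poor (enough-rich poor maximal 8m≤n 2mn≤total)
  where
  open Colouring G c symmetric proper
  open Thresholds (3 * m′) (4 * m′)
  open Completion m′
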